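{- Let $G$ be a finite connected graph and $P_r$ the path on $r$ vertices. If $r\geq {\rm diam}(G)\,|V(G)|$, then ${\rm ip}_{p}(P_r\,\square\, G)={\rm ip}_{c}(P_r\,\square\, G)=|V(G)|$.
   Context: $P_r\,\square\, G$ is the Cartesian product and ${\rm diam}(G)$ the diameter of $G$. A path is isometric if its length equals the distance between its endpoints; single vertices count as paths. ${\rm ip}_{c}(H)$ (resp. ${\rm ip}_{p}(H)$) is the minimum number of isometric paths of $H$ whose vertex sets cover (resp. partition) $V(H)$. -}

module Defs where

open import Data.Nat using (ℕ; zero; suc; _≤_; _+_)
open import Data.Fin using (Fin; zero; suc; toℕ; inject₁; fromℕ)
open import Data.Product using (Σ; ∃; ∃-syntax; _×_; _,_)
open import Data.Sum using (_⊎_)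
open import Relation.Binary.PropositionalEquality using (_≡_)
open import Relation.Nullary using (¬_)

record Graph (V : Set) : Set₁ where
  field
    Adj    : V → V → Set
    sym    : ∀ {u v} → Adj u v → Adj v u
    irrefl : ∀ {v} → ¬ Adj v v
open Graph public

data Walk {V : Set} (G : Graph V) : V → V → ℕ → Set where
  here : ∀ {v} → Walk G v v zero
  step : ∀ {u w v k} → Adj G u w → Walk G w v k → Walk G u v (suc k)

Dist : ∀ {V} → Graph V → V → V → ℕ → Set
Dist G u v d = Walk G u v d × (∀ k → Walk G u v k → d ≤ k)

Connected : ∀ {V} → Graph V → Set
Connected G = ∀ u v → ∃[ k ] Walk G u v k

IsDiam : ∀ {V} → Graph V → ℕ → Set
IsDiam G D = (∀ u v k → Dist G u v k → k ≤ D) × (∃[ u ] ∃[ v ] Dist G u v D)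

PathGraph : (r : ℕ) → Graph (Fin r)
PathGraph r = record
  { Adj = λ i j → (suc (toℕ i) ≡ toℕ j) ⊎ (suc (toℕ j) ≡ toℕ i)
  ; sym = λ { (Data.Sum.inj₁ e) → Data.Sum.inj₂ e ; (Data.Sum.inj₂ e) → Data.Sum.inj₁ e }
  ; irrefl = irr }
  where
    open import Data.Nat.Properties using (1+n≢n)
    open import Relation.Binary.PropositionalEquality using (sym)
    irr : ∀ {v} → ¬ ((suc (toℕ v) ≡ toℕ v) ⊎ (suc (toℕ v) ≡ toℕ v))
    irr {v} (Data.Sum.inj₁ e) = 1+n≢n e
    irr {v} (Data.Sum.inj₂ e) = 1+n≢n e

_□_ : ∀ {A B} → Graph A → Graph B → Graph (A × B)
_□_ {A} {B} H G = record { Adj = adj ; sym = sy ; irrefl = ir }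
  where
    adj : A × B → A × B → Set
    adj (a , u) (b , v) = (Adj H a b × u ≡ v) ⊎ (a ≡ b × Adj G u v)
    open import Relation.Binary.PropositionalEquality as Eq using ()
    sy : ∀ {x y} → adj x y → adj y x
    sy (Data.Sum.inj₁ (h , e)) = Data.Sum.inj₁ (Graph.sym H h , Eq.sym e)
    sy (Data.Sum.inj₂ (e , g)) = Data.Sum.inj₂ (Eq.sym e , Graph.sym G g)
    ir : ∀ {x} → ¬ adj x x
    ir (Data.Sum.inj₁ (h , _)) = Graph.irrefl H h
    ir (Data.Sum.inj₂ (_ , g)) = Graph.irrefl G g

IsIsoPath : ∀ {V} → Graph V → (k : ℕ) → (Fin (suc k) → V) → Set
IsIsoPath G k p =
  (∀ (j : Fin k) → Adj G (p (inject₁ j)) (p (suc j)))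
  × (∀ i j → p i ≡ p j → i ≡ j)
  × Dist G (p zero) (p (fromℕ k)) k

record IsoPathFamily {V : Set} (G : Graph V) (m : ℕ) : Set where
  field
    len  : Fin m → ℕ
    pt   : (i : Fin m) → Fin (suc (len i)) → V
    iso  : ∀ i → IsIsoPath G (len i) (pt i)
open IsoPathFamily public

Covers : ∀ {V} {G : Graph V} {m} → IsoPathFamily G m → Set
Covers {V} F = ∀ (v : V) → ∃[ i ] ∃[ j ] pt F i j ≡ v

Partitions : ∀ {V} {G : Graph V} {m} → IsoPathFamily G m → Set
Partitions F = Covers F × (∀ i i' j j' → pt F i j ≡ pt F i' j' → i ≡ i')

IsIpc : ∀ {V} → Graph V → ℕ → Set
IsIpc G m = (Σ (IsoPathFamily G m) Covers)
  × (∀ m' → (F : IsoPathFamily G m') → Covers F → m ≤ m')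

IsIpp : ∀ {V} → Graph V → ℕ → Set
IsIpp G m = (Σ (IsoPathFamily G m) Partitions)
  × (∀ m' → (F : IsoPathFamily G m') → Partitions F → m ≤ m')

-- The n fibres P_r × {u} are isometric paths partitioning the vertex set. Conversely, a geodesic
-- of P_r □ G projects to geodesics of both factors, so it has at most (r - 1) + D edges; m
-- isometric paths covering all r n vertices thus give r n ≤ m (r + D), and D n ≤ r forces m ≥ n.
module Submission where

open import Defs
open import Data.Nat using (ℕ; zero; suc; _+_; _*_; _∸_; _≤_; _<_; _≤?_; s≤s; s≤s⁻¹; z≤n)
open import Data.Nat.Properties
open import Data.Fin as Fin using (Fin; toℕ; fromℕ; fromℕ<; inject≤; combine)
open import Data.Fin.Properties
  using (toℕ-injective; toℕ-fromℕ; toℕ-fromℕ<; toℕ-inject₁; toℕ<n;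
         inject≤-injective; combine-injective; injective⇒≤; *↔×)
open import Data.Product using (_×_; ∃-syntax; _,_; proj₁; proj₂)
open import Data.Sum using (inj₁; inj₂)
open import Function using (_∘_; _↣_; Injection)
open import Function.Properties.Inverse using (↔⇒↣)
open import Relation.Nullary using (yes; no; contradiction)
open import Relation.Binary.PropositionalEquality as ≡ using (_≡_; refl; cong; subst)

DiamAtMost : ∀ {V} → Graph V → ℕ → Set
DiamAtMost G D = ∀ u v k → Dist G u v k → k ≤ D

module _ {V : Set} {G : Graph V} where

  _++ʷ_ : ∀ {u w v k l} → Walk G u w k → Walk G w v l → Walk G u v (k + l)
  here     ++ʷ q = q
  step a p ++ʷ q = step a (p ++ʷ q)

  snocʷ : ∀ {u w v k} → Walk G u w k → Adj G w v → Walk G u v (suc k)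
  snocʷ here       a = step a here
  snocʷ (step b p) a = step b (snocʷ p a)

  reverseʷ : ∀ {u v k} → Walk G u v k → Walk G v u k
  reverseʷ here       = here
  reverseʷ (step a p) = snocʷ (reverseʷ p) (Graph.sym G a)

module _ {r : ℕ} where

  ascending : ∀ d (a b : Fin r) → toℕ a + d ≡ toℕ b → Walk (PathGraph r) a b d
  ascending zero    a b a≡b =
    subst (λ c → Walk _ a c zero) (toℕ-injective (≡.trans (≡.sym (+-identityʳ (toℕ a))) a≡b)) here
  ascending (suc d) a b a+d+1≡b =
    step (inj₁ (≡.sym (toℕ-fromℕ< a+1<r))) (ascending d (fromℕ< a+1<r) b next+d≡b)
    where
      a+1+d≡b : suc (toℕ a) + d ≡ toℕ b
      a+1+d≡b = ≡.trans (≡.sym (+-suc (toℕ a) d)) a+d+1≡b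
      a+1<r : suc (toℕ a) < r
      a+1<r = ≤-<-trans (≤-trans (m≤m+n _ d) (≤-reflexive a+1+d≡b)) (toℕ<n b)
      next+d≡b : toℕ (fromℕ< a+1<r) + d ≡ toℕ b
      next+d≡b = ≡.trans (cong (_+ d) (toℕ-fromℕ< a+1<r)) a+1+d≡b

  short-walk : (a b : Fin r) → ∃[ k ] k < r × Walk (PathGraph r) a b k
  short-walk a b with toℕ a ≤? toℕ b
  ... | yes a≤b = toℕ b ∸ toℕ a , ≤-<-trans (m∸n≤m (toℕ b) (toℕ a)) (toℕ<n b)
                , ascending _ a b (m+[n∸m]≡n a≤b)
  ... | no a≰b  = toℕ a ∸ toℕ b , ≤-<-trans (m∸n≤m (toℕ a) (toℕ b)) (toℕ<n a)
                , reverseʷ (ascending _ b a (m+[n∸m]≡n (≰⇒≥ a≰b)))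

  walk-reach : ∀ {a b k} → Walk (PathGraph r) a b k → toℕ b ≤ toℕ a + k
  walk-reach {a} here = ≤-reflexive (≡.sym (+-identityʳ (toℕ a)))
  walk-reach {a} {b} {suc k} (step {w = w} edge p) = begin
    toℕ b           ≤⟨ walk-reach p ⟩
    toℕ w + k       ≤⟨ +-monoˡ-≤ k (edge-reach edge) ⟩
    suc (toℕ a) + k ≡⟨ ≡.sym (+-suc (toℕ a) k) ⟩
    toℕ a + suc k   ∎
    where
      open ≤-Reasoning
      edge-reach : Adj (PathGraph r) a w → toℕ w ≤ suc (toℕ a)
      edge-reach (inj₁ a+1≡w) = ≤-reflexive (≡.sym a+1≡w)
      edge-reach (inj₂ w+1≡a) = ≤-trans (n≤1+n _) (≤-trans (≤-reflexive w+1≡a) (n≤1+n _))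

PathGraph-diamAtMost : ∀ r' → DiamAtMost (PathGraph (suc r')) r'
PathGraph-diamAtMost r' a b k (_ , minimal) with short-walk a b
... | s , s<r , w = ≤-trans (minimal s w) (s≤s⁻¹ s<r)

PathGraph-ends-dist : ∀ r' → Dist (PathGraph (suc r')) Fin.zero (fromℕ r') r'
PathGraph-ends-dist r' =
  ascending r' Fin.zero (fromℕ r') (≡.sym (toℕ-fromℕ r')) ,
  λ k w → subst (_≤ k) (toℕ-fromℕ r') (walk-reach w)

module _ {A B : Set} {H : Graph A} {G : Graph B} where

  liftˡ : ∀ {a b k u} → Walk H a b k → Walk (H □ G) (a , u) (b , u) k
  liftˡ here       = here
  liftˡ (step e p) = step (inj₁ (e , refl)) (liftˡ p)

  liftʳ : ∀ {u v k a} → Walk G u v k → Walk (H □ G) (a , u) (a , v) k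
  liftʳ here       = here
  liftʳ (step e p) = step (inj₂ (refl , e)) (liftʳ p)

  split : ∀ {a u b v k} → Walk (H □ G) (a , u) (b , v) k →
          ∃[ kH ] ∃[ kG ] Walk H a b kH × Walk G u v kG × kH + kG ≡ k
  split here = 0 , 0 , here , here , refl
  split (step (inj₁ (e , refl)) p) with split p
  ... | kH , kG , wH , wG , sum = suc kH , kG , step e wH , wG , cong suc sum
  split (step (inj₂ (refl , e)) p) with split p
  ... | kH , kG , wH , wG , sum = kH , suc kG , wH , step e wG , ≡.trans (+-suc kH kG) (cong suc sum)

  -- A geodesic splits into geodesics of the factors: shortening either part would shorten the whole.
  split-dist : ∀ {a u b v k} → Dist (H □ G) (a , u) (b , v) k →
               ∃[ kH ] ∃[ kG ] Dist H a b kH × Dist G u v kG × kH + kG ≡ k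
  split-dist {a} {u} {b} {v} (w , minimal) with split w
  ... | kH , kG , wH , wG , sum = kH , kG , (wH , H-minimal) , (wG , G-minimal) , sum
    where
      H-minimal : ∀ k' → Walk H a b k' → kH ≤ k'
      H-minimal k' w' = +-cancelʳ-≤ kG kH k'
        (subst (_≤ k' + kG) (≡.sym sum) (minimal _ (liftˡ w' ++ʷ liftʳ wG)))
      G-minimal : ∀ k' → Walk G u v k' → kG ≤ k'
      G-minimal k' w' = +-cancelˡ-≤ kH kG k'
        (subst (_≤ kH + k') (≡.sym sum) (minimal _ (liftˡ wH ++ʷ liftʳ w')))

  liftˡ-dist : ∀ {a b k u} → Dist H a b k → Dist (H □ G) (a , u) (b , u) k
  liftˡ-dist {a} {b} {k} {u} (w , minimal) = liftˡ w , bound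
    where
      bound : ∀ k' → Walk (H □ G) (a , u) (b , u) k' → k ≤ k'
      bound k' w' with split w'
      ... | kH , kG , wH , _ , sum = ≤-trans (minimal kH wH) (subst (kH ≤_) sum (m≤m+n kH kG))

  □-diamAtMost : ∀ {D₁ D₂} → DiamAtMost H D₁ → DiamAtMost G D₂ → DiamAtMost (H □ G) (D₁ + D₂)
  □-diamAtMost boundH boundG (a , u) (b , v) k d with split-dist d
  ... | kH , kG , dH , dG , sum =
    subst (_≤ _) sum (+-mono-≤ (boundH a b kH dH) (boundG u v kG dG))

covering-size : ∀ {V} {G : Graph V} {m L N} (F : IsoPathFamily G m) → Covers F →
                (∀ i → len F i < L) → Fin N ↣ V → N ≤ m * L
covering-size {V} {m = m} {L} F cover len<L ι =
  injective⇒≤ {f = index ∘ Injection.to ι} (Injection.injective ι ∘ index-injective)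
  where
    index : V → Fin (m * L)
    index v with cover v
    ... | i , j , _ = combine i (inject≤ j (len<L i))

    index-injective : ∀ {x y} → index x ≡ index y → x ≡ y
    index-injective {x} {y} same with cover x | cover y
    ... | i , j , pij≡x | i' , j' , pi'j'≡y with combine-injective i _ i' _ same
    ... | refl , j≈j' =
      ≡.trans (≡.sym pij≡x) (≡.trans (cong (pt F i) (inject≤-injective _ _ j j' j≈j')) pi'j'≡y)

count⇒≤ : ∀ {n m r D} → 0 < r → D * n ≤ r → r * n ≤ m * (r + D) → n ≤ m
count⇒≤ {n} {m} {r} {D} r>0 Dn≤r count with n ≤? m
... | yes n≤m = n≤m
... | no n≰m  = contradiction count (<⇒≱ (begin-strict
  m * (r + D)   ≡⟨ *-distribˡ-+ m r D ⟩
  m * r + m * D <⟨ +-monoʳ-< (m * r) (mD<r D Dn≤r) ⟩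
  m * r + r     ≡⟨ +-comm (m * r) r ⟩
  suc m * r     ≤⟨ *-monoˡ-≤ r (≰⇒> n≰m) ⟩
  n * r         ≡⟨ *-comm n r ⟩
  r * n         ∎))
  where
    open ≤-Reasoning
    mD<r : ∀ d → d * n ≤ r → m * d < r
    mD<r zero      _    = subst (_< r) (≡.sym (*-zeroʳ m)) r>0
    mD<r d@(suc _) dn≤r = ≤-trans (*-monoˡ-< d (≰⇒> n≰m)) (subst (_≤ r) (*-comm d n) dn≤r)

columns : ∀ {n} r' (G : Graph (Fin n)) → IsoPathFamily (PathGraph (suc r') □ G) n
columns r' G = record { len = λ _ → r' ; pt = λ u j → j , u ; iso = column-iso }
  where
    column-iso : ∀ u → IsIsoPath (PathGraph (suc r') □ G) r' (λ j → j , u)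
    column-iso u = (λ j → inj₁ (inj₁ (cong suc (toℕ-inject₁ j)) , refl))
                 , (λ _ _ → cong proj₁)
                 , liftˡ-dist (PathGraph-ends-dist r')

columns-partition : ∀ {n} r' (G : Graph (Fin n)) → Partitions (columns r' G)
columns-partition r' G = (λ (j , u) → u , j , refl) , (λ _ _ _ _ → cong proj₂)

covering-lower-bound : ∀ {n r' D m} (G : Graph (Fin n)) → DiamAtMost G D → D * n ≤ suc r' →
                       (F : IsoPathFamily (PathGraph (suc r') □ G) m) → Covers F → n ≤ m
covering-lower-bound {r' = r'} {D} G diam Dn≤r F cover =
  count⇒≤ (s≤s z≤n) Dn≤r (covering-size F cover path-short (↔⇒↣ *↔×))
  where
    path-short : ∀ i → len F i < suc r' + D
    path-short i = s≤s (□-diamAtMost (PathGraph-diamAtMost r') diam _ _ _ (proj₂ (proj₂ (iso F i))))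

theorem5 : (n : ℕ) (G : Graph (Fin n)) (D r : ℕ)
    → 1 ≤ n → Connected G → IsDiam G D
    → 1 ≤ r → D * n ≤ r
    → IsIpp (PathGraph r □ G) n × IsIpc (PathGraph r □ G) n
theorem5 n G D (suc r') _ _ (diam , _) _ Dn≤r =
  ((columns r' G , columns-partition r' G) , λ m F → lower-bound m F ∘ proj₁) ,
  ((columns r' G , proj₁ (columns-partition r' G)) , lower-bound)
  where
    lower-bound : ∀ m (F : IsoPathFamily (PathGraph (suc r') □ G) m) → Covers F → n ≤ m
    lower-bound m = covering-lower-bound G diam Dn≤r
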